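{- Let $\mathbb G$ be a finite graph. Then $\mathbb G$ maps homomorphically to every graph $\mathbb H$ that contains a copy of $\mathbb K_3$ (three pairwise adjacent vertices) and whose polymorphism clone $\operatorname{Pol}(\mathbb H)$ satisfies $\Sigma_{\mathbb G}$.
   Context: Graphs are structures with a single symmetric binary relation $E$; $\mathbb K_3$ is the complete loopless graph on three vertices. $\operatorname{Pol}(\mathbb H)$ is the set of all homomorphisms $\mathbb H^n\to\mathbb H$ ($n\ge1$), where $\mathbb H^n$ has vertex set $H^n$ and edges between tuples adjacent in every coordinate. For a finite graph $\mathbb G=(V,E)$, the height 1 condition $\Sigma_{\mathbb G}$ has a ternary function symbol $f_v$ for each $v\in V$ and a 6-ary symbol $g_{(u,v)}$ for each $(u,v)\in E$, with identities $f_u(x,y,z)\approx g_{(u,v)}(x,y,x,z,y,z)$ and $f_v(x,y,z)\approx g_{(u,v)}(y,x,z,x,z,y)$ for each $(u,v)\in E$. A set of operations satisfies $\Sigma_{\mathbb G}$ if the symbols can be interpreted by operations in it of matching arities so that all identities hold for all values of the variables. -}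

module Defs where

open import Level using (Level; suc; _⊔_)
open import Data.Nat using (ℕ)
open import Data.Fin using (Fin)
open import Data.Vec using (Vec; lookup; _∷_; [])
import Data.Product
open Data.Product using (Σ; ∃; _×_; _,_)
open import Relation.Binary.PropositionalEquality using (_≡_; _≢_)

-- A graph: a single symmetric binary relation E on a vertex set V
-- (loops are not excluded).
record Graph {ℓ : Level} (V : Set ℓ) : Set (suc ℓ) where
  field
    E   : V → V → Set ℓ
    sym : ∀ {x y} → E x y → E y x
open Graph public

IsHom : ∀ {a b} {V : Set a} {W : Set b} → Graph V → Graph W → (V → W) → Set (a ⊔ b)
IsHom G H h = ∀ x y → E G x y → E H (h x) (h y)

Hom : ∀ {a b} {V : Set a} {W : Set b} → Graph V → Graph W → Set (a ⊔ b)
Hom {W = W} G H = Σ (_ → W) (IsHom G H)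

IsPol : ∀ {ℓ} {V : Set ℓ} (H : Graph V) (n : ℕ) → (Vec V n → V) → Set ℓ
IsPol {V = V} H n f = ∀ (as bs : Vec V n) → (∀ i → E H (lookup as i) (lookup bs i)) → E H (f as) (f bs)

Pol : ∀ {ℓ} {V : Set ℓ} (H : Graph V) (n : ℕ) → Set ℓ
Pol {V = V} H n = Σ (Vec V n → V) (IsPol H n)

ContainsK3 : ∀ {ℓ} {V : Set ℓ} → Graph V → Set ℓ
ContainsK3 {V = V} H =
  Σ V λ a → Σ V λ b → Σ V λ c →
    (a ≢ b) × (b ≢ c) × (a ≢ c) × E H a b × E H b c × E H a c

SatisfiesΣ : ∀ {ℓ} {n : ℕ} (G : Graph {Level.zero} (Fin n)) {V : Set ℓ} (H : Graph V) → Set ℓ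
SatisfiesΣ {n = n} G {V} H =
  Σ ((v : Fin n) → Pol H 3) λ f →
  Σ ((u v : Fin n) → E G u v → Pol H 6) λ g →
    ∀ u v (e : E G u v) (x y z : V) →
      (Data.Product.proj₁ (f u) (x ∷ y ∷ z ∷ []) ≡ Data.Product.proj₁ (g u v e) (x ∷ y ∷ x ∷ z ∷ y ∷ z ∷ []))
    × (Data.Product.proj₁ (f v) (x ∷ y ∷ z ∷ []) ≡ Data.Product.proj₁ (g u v e) (y ∷ x ∷ z ∷ x ∷ z ∷ y ∷ []))

module Submission where

-- Let a, b, c be pairwise adjacent
-- vertices of H and let (f, g) witness that Pol(H) satisfies Σ_G.  The map
--   h(v) = f_v(a, b, c)
-- is a homomorphism G → H.  For an edge (u, v) of G, the identities of Σ_G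
-- rewrite h(u) and h(v) as values of the single 6-ary polymorphism g_(u,v):
--   h(u) = g_(u,v)(a, b, a, c, b, c),   h(v) = g_(u,v)(b, a, c, a, c, b).
-- The two argument tuples are adjacent in every coordinate, because each
-- column is one of the edges ab, ba, ac, ca, bc, cb of the triangle; so
-- g_(u,v) sends them to adjacent vertices.

open import Defs
open import Data.Nat using (ℕ)
open import Data.Fin using (Fin; zero; suc)
open import Data.Vec using (Vec; lookup; _∷_; [])
open import Data.Product using (_,_; proj₁; proj₂)
open import Relation.Binary.PropositionalEquality using (_≡_; subst₂) renaming (sym to ≡-sym)

left-tuple right-tuple : ∀ {ℓ} {V : Set ℓ} → V → V → V → Vec V 6
left-tuple  x y z = x ∷ y ∷ x ∷ z ∷ y ∷ z ∷ []
right-tuple x y z = y ∷ x ∷ z ∷ x ∷ z ∷ y ∷ []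

triangle-tuples-adjacent : ∀ {ℓ} {V : Set ℓ} (H : Graph V) {a b c : V} →
  E H a b → E H b c → E H a c →
  (i : Fin 6) → E H (lookup (left-tuple a b c) i) (lookup (right-tuple a b c) i)
triangle-tuples-adjacent H eab ebc eac zero                               = eab
triangle-tuples-adjacent H eab ebc eac (suc zero)                         = Graph.sym H eab
triangle-tuples-adjacent H eab ebc eac (suc (suc zero))                   = eac
triangle-tuples-adjacent H eab ebc eac (suc (suc (suc zero)))             = Graph.sym H eac
triangle-tuples-adjacent H eab ebc eac (suc (suc (suc (suc zero))))       = ebc
triangle-tuples-adjacent H eab ebc eac (suc (suc (suc (suc (suc zero))))) = Graph.sym H ebc

evaluation-at-triangle-is-hom : ∀ {ℓ} {n : ℕ} (G : Graph (Fin n)) {V : Set ℓ} (H : Graph V)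
  (σ : SatisfiesΣ G H) {a b c : V} →
  E H a b → E H b c → E H a c →
  IsHom G H (λ v → proj₁ (proj₁ σ v) (a ∷ b ∷ c ∷ []))
evaluation-at-triangle-is-hom G H (f , g , identities) {a} {b} {c} eab ebc eac u v e =
  subst₂ (E H) (≡-sym f-u≡g-left) (≡-sym f-v≡g-right) g-left~g-right
  where
  f-u≡g-left : proj₁ (f u) (a ∷ b ∷ c ∷ []) ≡ proj₁ (g u v e) (left-tuple a b c)
  f-u≡g-left = proj₁ (identities u v e a b c)
  f-v≡g-right : proj₁ (f v) (a ∷ b ∷ c ∷ []) ≡ proj₁ (g u v e) (right-tuple a b c)
  f-v≡g-right = proj₂ (identities u v e a b c)
  g-left~g-right : E H (proj₁ (g u v e) (left-tuple a b c)) (proj₁ (g u v e) (right-tuple a b c))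
  g-left~g-right = proj₂ (g u v e) (left-tuple a b c) (right-tuple a b c)
                     (triangle-tuples-adjacent H eab ebc eac)

lemma3p2 : ∀ {ℓ} (n : ℕ) (G : Graph (Fin n)) {V : Set ℓ} (H : Graph V) →
    ContainsK3 H → SatisfiesΣ G H → Hom G H
lemma3p2 n G H (a , b , c , _ , _ , _ , eab , ebc , eac) σ =
  (λ v → proj₁ (proj₁ σ v) (a ∷ b ∷ c ∷ [])) ,
  evaluation-at-triangle-is-hom G H σ eab ebc eac
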